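{- Let $d\ge 1$ and let $G$ be a bridgeless connected graph with $d(G)=d$ and maximum edge girth $g^*(G)\in\{2,3\}$. Then there is an orientation $\overrightarrow{G}$ of $G$ such that $d(\overrightarrow{G})=d$ if $g^*(G)=2$, and $d(\overrightarrow{G})\le 3d$ if $g^*(G)=3$.
   Context: Graphs are finite, connected, without loops, but multiple (parallel) edges are allowed; two parallel edges form a cycle of length $2$. $d(G)$ is the diameter of $G$ (maximum over pairs of vertices of the length of a shortest path). A bridge is an edge whose deletion disconnects the graph; $G$ is bridgeless if it has none. For an edge $e$ of a bridgeless graph $G$, the edge girth $l_G(e)$ is the length of a shortest cycle containing $e$, and the maximum edge girth is $g^*(G)=\max\{l_G(e): e\in E(G)\}$. An orientation $\overrightarrow{G}$ assigns one direction to each edge; $\partial(u,v)$ is the length of a shortest directed path from $u$ to $v$, and $d(\overrightarrow{G})=\max_{u,v}\partial(u,v)$ (infinite if the orientation is not strongly connected). -}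

module Defs where

open import Data.Nat using (ℕ; zero; suc; _+_; _*_; _≤_; _<_; _%_)
open import Data.Nat.DivMod using (m%n<n)
open import Data.Fin using (Fin; toℕ; fromℕ<)
open import Data.Bool using (Bool; true; false)
open import Data.Unit using (⊤)
open import Data.Product using (Σ; ∃; _×_; _,_)
open import Data.Sum using (_⊎_)
open import Relation.Binary.PropositionalEquality using (_≡_; _≢_)
open import Relation.Nullary using (¬_)
open import Function.Definitions using (Injective)

-- A finite loopless multigraph: vertices Fin n, edges Fin m, each edge e
-- has two (distinct) endpoints src e and tgt e.  Parallel edges allowed.
record Multigraph : Set where
  field
    n   : ℕ
    m   : ℕ
    src : Fin m → Fin n
    tgt : Fin m → Fin n
    loopless : ∀ e → src e ≢ tgt e

module _ (G : Multigraph) where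
  open Multigraph G

  Vertex : Set
  Vertex = Fin n

  Edge : Set
  Edge = Fin m

  Joins : Edge → Vertex → Vertex → Set
  Joins e a b = (src e ≡ a × tgt e ≡ b) ⊎ (src e ≡ b × tgt e ≡ a)

  data Walk (P : Edge → Set) : Vertex → Vertex → ℕ → Set where
    []   : ∀ {u} → Walk P u u 0
    step : ∀ {u w v k} (e : Edge) → P e → Joins e u w → Walk P w v k → Walk P u v (suc k)

  AnyEdge : Edge → Set
  AnyEdge _ = ⊤

  Connected : Set
  Connected = ∀ u v → ∃ λ k → Walk AnyEdge u v k

  Bridgeless : Set
  Bridgeless = ∀ (e : Edge) u v → ∃ λ k → Walk (λ f → f ≢ e) u v k

  Dist : Vertex → Vertex → ℕ → Set
  Dist u v k = Walk AnyEdge u v k × (∀ j → j < k → ¬ Walk AnyEdge u v j)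

  Diameter : ℕ → Set
  Diameter d = (∀ u v → ∃ λ k → k ≤ d × Dist u v k)
             × (∃ λ u → ∃ λ v → Dist u v d)

  next : ∀ {j} → Fin (suc j) → Fin (suc j)
  next {j} i = fromℕ< (m%n<n (suc (toℕ i)) (suc j))

  record Cycle : Set where
    field
      j       : ℕ
      vtx     : Fin (suc (suc j)) → Vertex
      edg     : Fin (suc (suc j)) → Edge
      vtx-inj : Injective _≡_ _≡_ vtx
      edg-inj : Injective _≡_ _≡_ edg
      joins   : ∀ i → Joins (edg i) (vtx i) (vtx (next i))

  cycleLength : Cycle → ℕ
  cycleLength C = suc (suc (Cycle.j C))

  ContainsEdge : Cycle → Edge → Set
  ContainsEdge C e = ∃ λ i → Cycle.edg C i ≡ e

  EdgeGirth : Edge → ℕ → Set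
  EdgeGirth e k = (∃ λ C → ContainsEdge C e × cycleLength C ≡ k)
                × (∀ (C : Cycle) → ContainsEdge C e → k ≤ cycleLength C)

  MaxEdgeGirth : ℕ → Set
  MaxEdgeGirth g = (∀ e → ∃ λ k → EdgeGirth e k × k ≤ g)
                 × (∃ λ e → EdgeGirth e g)

  -- an orientation: true means e is directed src e → tgt e, false the reverse
  Orientation : Set
  Orientation = Edge → Bool

  tail head : Orientation → Edge → Vertex
  tail o e with o e
  ... | true  = src e
  ... | false = tgt e
  head o e with o e
  ... | true  = tgt e
  ... | false = src e

  data DWalk (o : Orientation) : Vertex → Vertex → ℕ → Set where
    []   : ∀ {u} → DWalk o u u 0
    step : ∀ {v k} (e : Edge) → DWalk o (head o e) v k → DWalk o (tail o e) v (suc k)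

  DDist : Orientation → Vertex → Vertex → ℕ → Set
  DDist o u v k = DWalk o u v k × (∀ j → j < k → ¬ DWalk o u v j)

  DDiameter : Orientation → ℕ → Set
  DDiameter o d = (∀ u v → ∃ λ k → k ≤ d × DDist o u v k)
                × (∃ λ u → ∃ λ v → DDist o u v d)

  DDiameter≤ : Orientation → ℕ → Set
  DDiameter≤ o D = ∀ u v → ∃ λ k → k ≤ D × DWalk o u v k

{-# OPTIONS --safe #-}
-- Orient the edges greedily, keeping every oriented edge a → b on a directed return path b ⇝ a
-- of length at most B = g - 1.  An unoriented edge e lies on a digon or triangle, which is then
-- oriented cyclically in the direction agreeing with its already oriented edges.  The only
-- obstruction is a triangle whose other two edges are already oriented both into, or both out of,
-- their common vertex w; then e is traversed either way in B + 1 steps through w, and it stays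
-- unoriented so that the invariant is not weakened.
-- Eventually every edge can be traversed both ways within 1 (g = 2) resp. 3 (g = 3) steps, so a
-- walk of length k becomes a directed walk of length at most k resp. 3k.
module Submission where

open import Defs
open import Data.Bool using (Bool; true; false)
open import Data.Fin using (Fin; zero; suc; _≟_)
open import Data.List using (List; []; _∷_; allFin)
open import Data.List.Membership.Propositional.Properties using (∈-allFin)
open import Data.List.Relation.Unary.All as All using (All; []; _∷_)
open import Data.Maybe using (Maybe; just; nothing; fromMaybe; _<∣>_)
open import Data.Maybe.Properties using (just-injective)
open import Data.Nat using (ℕ; suc; _+_; _*_; _≤_; z≤n; s≤s)
open import Data.Nat.Properties
  using (≤-refl; ≤-trans; n≤1+n; ≤-reflexive; ≤-antisym; ≮⇒≥; +-mono-≤; +-comm; *-suc; *-identityˡ; *-monoʳ-≤)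
open import Data.Product using (Σ; ∃; _×_; _,_)
open import Data.Sum using (_⊎_; inj₁; inj₂)
open import Data.Unit using (tt)
open import Data.Vec.Functional using (updateAt)
open import Data.Vec.Functional.Properties using (updateAt-updates; updateAt-minimal)
open import Function using (const)
open import Function.Definitions using (Injective)
open import Relation.Nullary using (yes; no)
open import Relation.Binary.PropositionalEquality using (_≡_; _≢_; refl; sym; trans; cong; subst)

data Path {V : Set} (R : V → V → Set) : V → V → ℕ → Set where
  []  : ∀ {a} → Path R a a 0
  _∷_ : ∀ {a b c k} → R a b → Path R b c k → Path R a c (suc k)

Within : {V : Set} → (V → V → Set) → ℕ → V → V → Set
Within R n a b = ∃ λ k → k ≤ n × Path R a b k

module _ {V : Set} {R : V → V → Set} where
  private variable
    a b c : V
    k l m n : ℕ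

  _++_ : Path R a b k → Path R b c l → Path R a c (k + l)
  []      ++ q = q
  (r ∷ p) ++ q = r ∷ (p ++ q)

  map : {S : V → V → Set} → (∀ {x y} → R x y → S x y) → Path R a b k → Path S a b k
  map f []      = []
  map f (r ∷ p) = f r ∷ map f p

  within-one : R a b → Within R 1 a b
  within-one r = 1 , ≤-refl , r ∷ []

  within-weaken : m ≤ n → Within R m a b → Within R n a b
  within-weaken m≤n (k , k≤m , p) = k , ≤-trans k≤m m≤n , p

  within-++ : Within R m a b → Within R n b c → Within R (m + n) a c
  within-++ (k , k≤m , p) (l , l≤n , q) = k + l , +-mono-≤ k≤m l≤n , p ++ q

  within-map : {S : V → V → Set} → (∀ {x y} → R x y → S x y) → Within R n a b → Within S n a b
  within-map f (k , k≤n , p) = k , k≤n , map f p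

module _ (G : Multigraph) where
  open Multigraph G

  private variable
    a b c x y : Vertex G
    e : Edge G
    β : Bool
    B C k : ℕ

  dir : Joins G e a b → Bool
  dir (inj₁ _) = true
  dir (inj₂ _) = false

  joins-sym : Joins G e a b → Joins G e b a
  joins-sym (inj₁ (s , t)) = inj₂ (s , t)
  joins-sym (inj₂ (s , t)) = inj₁ (s , t)

  endpoints : ∀ e → Joins G e (src e) (tgt e)
  endpoints e = inj₁ (refl , refl)

  dir-cases : (J : Joins G e a b) (β : Bool) → β ≡ dir J ⊎ β ≡ dir (joins-sym J)
  dir-cases (inj₁ _) true  = inj₁ refl
  dir-cases (inj₁ _) false = inj₂ refl
  dir-cases (inj₂ _) true  = inj₂ refl
  dir-cases (inj₂ _) false = inj₁ refl

  dir-determines-ends : (J : Joins G e a b) (J′ : Joins G e x y) → dir J ≡ dir J′ → a ≡ x × b ≡ y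
  dir-determines-ends (inj₁ (s , t)) (inj₁ (s′ , t′)) _ = trans (sym s) s′ , trans (sym t) t′
  dir-determines-ends (inj₂ (s , t)) (inj₂ (s′ , t′)) _ = trans (sym t) t′ , trans (sym s) s′

  joins-ends : Joins G e a b → Joins G e x y → (x ≡ a × y ≡ b) ⊎ (x ≡ b × y ≡ a)
  joins-ends J J′ with dir-cases J (dir J′)
  ... | inj₁ d = inj₁ (dir-determines-ends J′ J d)
  ... | inj₂ d = inj₂ (dir-determines-ends J′ (joins-sym J) d)

  Partial : Set
  Partial = Edge G → Maybe Bool

  private variable p q π : Partial

  ∅ : Partial
  ∅ _ = nothing

  total : Orientation G → Partial
  total o e = just (o e)

  complete : Partial → Orientation G
  complete p e = fromMaybe true (p e)

  _[_↦_] : Partial → Edge G → Bool → Partial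
  p [ e ↦ β ] = updateAt p e (const (just β))

  _∪_ : Partial → Partial → Partial
  (π ∪ p) e = π e <∣> p e

  _⊑_ : Partial → Partial → Set
  p ⊑ q = ∀ e {β} → p e ≡ just β → q e ≡ just β

  Free : Partial → Edge G → Bool → Set
  Free p e β = p e ≡ nothing ⊎ p e ≡ just β

  Compatible : Partial → Partial → Set
  Compatible π p = ∀ e {β} → π e ≡ just β → Free p e β

  data Arc (p : Partial) (a b : Vertex G) : Set where
    arc : ∀ e (J : Joins G e a b) → p e ≡ just (dir J) → Arc p a b

  Reach : Partial → ℕ → Vertex G → Vertex G → Set
  Reach p = Within (Arc p)

  Returns : ℕ → Partial → Set
  Returns B p = ∀ {a b} → Arc p a b → Reach p B b a

  Traversable : ℕ → Partial → Edge G → Set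
  Traversable C p e = ∀ {a b} → Joins G e a b → Reach p C a b

  Settling : ℕ → ℕ → Partial → Edge G → Set
  Settling B C p e = ∃ λ q → p ⊑ q × Returns B q × Traversable C q e

  ⊑-refl : p ⊑ p
  ⊑-refl _ eq = eq

  ⊑-trans : p ⊑ q → q ⊑ π → p ⊑ π
  ⊑-trans p⊑q q⊑π e eq = q⊑π e (p⊑q e eq)

  reach-⊑ : p ⊑ q → Reach p k a b → Reach q k a b
  reach-⊑ p⊑q = within-map λ { (arc e J eq) → arc e J (p⊑q e eq) }

  traversable-⊑ : p ⊑ q → Traversable C p e → Traversable C q e
  traversable-⊑ p⊑q t J = reach-⊑ p⊑q (t J)

  traversable-weaken : B ≤ C → Traversable B p e → Traversable C p e
  traversable-weaken B≤C t J = within-weaken B≤C (t J)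

  returns-weaken : B ≤ C → Returns B p → Returns C p
  returns-weaken B≤C r α = within-weaken B≤C (r α)

  returns-∅ : Returns B ∅
  returns-∅ (arc _ _ ())

  complete-⊒ : ∀ p → p ⊑ total (complete p)
  complete-⊒ p e eq rewrite eq = refl

  ↦-self : ∀ p e β → (p [ e ↦ β ]) e ≡ just β
  ↦-self p e β = updateAt-updates e p

  ↦-other : ∀ p {e f} β → f ≢ e → (p [ e ↦ β ]) f ≡ p f
  ↦-other p {e} {f} β f≢e = updateAt-minimal f e p f≢e

  ↦-just : ∀ p e {β γ} f → (p [ e ↦ β ]) f ≡ just γ → (f ≡ e × β ≡ γ) ⊎ p f ≡ just γ
  ↦-just p e {β} f eq with f ≟ e
  ... | yes refl = inj₁ (refl , just-injective (trans (sym (↦-self p e β)) eq))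
  ... | no f≢e   = inj₂ (trans (sym (↦-other p β f≢e)) eq)

  compatible-∅ : Compatible ∅ p
  compatible-∅ _ ()

  compatible-↦ : Compatible π p → Free p e β → Compatible (π [ e ↦ β ]) p
  compatible-↦ {π} {e = e} compat free f eq with ↦-just π e f eq
  ... | inj₁ (refl , refl) = free
  ... | inj₂ eq′           = compat f eq′

  ∪-⊒ˡ : ∀ π p → π ⊑ (π ∪ p)
  ∪-⊒ˡ π p e eq rewrite eq = refl

  ∪-⊒ʳ : Compatible π p → p ⊑ (π ∪ p)
  ∪-⊒ʳ {π} compat e eq with π e in πe
  ... | nothing = eq
  ... | just γ with compat e πe
  ...   | inj₂ p≡γ       = trans (sym p≡γ) eq
  ...   | inj₁ p≡nothing with trans (sym p≡nothing) eq
  ...     | ()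

  ∪-just : ∀ π p e → (π ∪ p) e ≡ just β → π e ≡ just β ⊎ p e ≡ just β
  ∪-just π p e eq with π e
  ... | just _  = inj₁ eq
  ... | nothing = inj₂ eq

  returns-∪ : Returns B π → Returns B p → Compatible π p → Returns B (π ∪ p)
  returns-∪ {π = π} {p = p} rπ rp compat (arc e J eq) with ∪-just π p e eq
  ... | inj₁ πe = reach-⊑ (∪-⊒ˡ π p) (rπ (arc e J πe))
  ... | inj₂ pe = reach-⊑ (∪-⊒ʳ compat) (rp (arc e J pe))

  traversable-between : Joins G e a b → Reach p C a b → Reach p C b a → Traversable C p e
  traversable-between J ab ba J′ with joins-ends J J′
  ... | inj₁ (refl , refl) = ab
  ... | inj₂ (refl , refl) = ba

  arc-traversable : 1 ≤ C → B ≤ C → Returns B p → (J : Joins G e a b) → p e ≡ just (dir J)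
                  → Traversable C p e
  arc-traversable 1≤C B≤C r J eq =
    traversable-between J (within-weaken 1≤C (within-one α)) (within-weaken B≤C (r α))
    where α = arc _ J eq

  oriented-traversable : 1 ≤ C → B ≤ C → Returns B p → p e ≡ just β → Traversable C p e
  oriented-traversable {e = e} {β = true}  1≤C B≤C r eq = arc-traversable 1≤C B≤C r (endpoints e) eq
  oriented-traversable {e = e} {β = false} 1≤C B≤C r eq =
    arc-traversable 1≤C B≤C r (joins-sym (endpoints e)) eq

  settle-oriented : 1 ≤ C → B ≤ C → Returns B p → p e ≡ just β → Settling B C p e
  settle-oriented {p = p} 1≤C B≤C r eq = p , ⊑-refl , r , oriented-traversable 1≤C B≤C r eq

  settle-by-plan : 1 ≤ C → B ≤ C → Returns B p → Returns B π → Compatible π p → π e ≡ just β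
            → Settling B C p e
  settle-by-plan {p = p} {π = π} 1≤C B≤C rp rπ compat πe =
    π ∪ p , ∪-⊒ʳ compat , r , oriented-traversable 1≤C B≤C r (∪-⊒ˡ π p _ πe)
    where r = returns-∪ rπ rp compat

  wedge-traversable : Returns B p → Joins G e a b → (Arc p a c × Arc p b c) ⊎ (Arc p c a × Arc p c b)
                    → Traversable (suc B) p e
  wedge-traversable r J (inj₁ (ac , bc)) =
    traversable-between J (within-++ (within-one ac) (r bc)) (within-++ (within-one bc) (r ac))
  wedge-traversable {B} r J (inj₂ (ca , cb)) =
    traversable-between J (around (r ca) cb) (around (r cb) ca)
    where
    around : ∀ {p x y z} → Reach p B x z → Arc p z y → Reach p (suc B) x y
    around xz zy = within-weaken (≤-reflexive (+-comm B 1)) (within-++ xz (within-one zy))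

  data Status (p : Partial) {e a b} (J : Joins G e a b) : Set where
    unset   : p e ≡ nothing → Status p J
    along   : p e ≡ just (dir J) → Status p J
    against : p e ≡ just (dir (joins-sym J)) → Status p J

  status : ∀ p (J : Joins G e a b) → Status p J
  status {e = e} p J with p e in eq
  ... | nothing = unset eq
  ... | just β with dir-cases J β
  ...   | inj₁ refl = along eq
  ...   | inj₂ refl = against eq

  -- Digons and triangles

  record Digon (e : Edge G) : Set where
    field
      {u v}   : Vertex G
      partner : Edge G
      e-joins : Joins G e u v
      partner-joins : Joins G partner v u
      distinct : e ≢ partner

  reverse-digon : Digon e → Digon e
  reverse-digon D = record
    { partner = partner ; e-joins = joins-sym e-joins ; partner-joins = joins-sym partner-joins
    ; distinct = distinct }
    where open Digon D

  module _ {e} (D : Digon e) where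
    open Digon D

    digon-plan : Partial
    digon-plan = ∅ [ e ↦ dir e-joins ] [ partner ↦ dir partner-joins ]

    digon-plan-e : digon-plan e ≡ just (dir e-joins)
    digon-plan-e = trans (↦-other _ _ distinct) (↦-self ∅ e _)

    digon-plan-returns : Returns 1 digon-plan
    digon-plan-returns (arc y J eq) with ↦-just _ partner y eq
    ... | inj₁ (refl , d) with dir-determines-ends partner-joins J d
    ...   | refl , refl = within-one (arc e e-joins digon-plan-e)
    digon-plan-returns (arc y J eq) | inj₂ eq′ with ↦-just ∅ e y eq′
    ... | inj₁ (refl , d) with dir-determines-ends e-joins J d
    ...   | refl , refl = within-one (arc partner partner-joins (↦-self _ partner _))
    digon-plan-returns (arc y J eq) | inj₂ eq′ | inj₂ ()

    digon-plan-compatible : Free p e (dir e-joins) → Free p partner (dir partner-joins)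
                          → Compatible digon-plan p
    digon-plan-compatible free-e free-partner =
      compatible-↦ (compatible-↦ compatible-∅ free-e) free-partner

  record Triangle (e : Edge G) : Set where
    field
      {u v w} : Vertex G
      f h     : Edge G
      e-joins : Joins G e u v
      f-joins : Joins G f v w
      h-joins : Joins G h w u
      e≢f : e ≢ f
      f≢h : f ≢ h
      e≢h : e ≢ h

  reverse-triangle : Triangle e → Triangle e
  reverse-triangle T = record
    { f = h ; h = f
    ; e-joins = joins-sym e-joins ; f-joins = joins-sym h-joins ; h-joins = joins-sym f-joins
    ; e≢f = e≢h ; f≢h = λ h≡f → f≢h (sym h≡f) ; e≢h = e≢f }
    where open Triangle T

  module _ {e} (T : Triangle e) where
    open Triangle T

    triangle-plan : Partial
    triangle-plan = ∅ [ e ↦ dir e-joins ] [ f ↦ dir f-joins ] [ h ↦ dir h-joins ]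

    triangle-plan-e : triangle-plan e ≡ just (dir e-joins)
    triangle-plan-e = trans (↦-other _ _ e≢h) (trans (↦-other _ _ e≢f) (↦-self ∅ e _))

    private
      arc-e : Arc triangle-plan u v
      arc-e = arc e e-joins triangle-plan-e

      arc-f : Arc triangle-plan v w
      arc-f = arc f f-joins (trans (↦-other _ _ f≢h) (↦-self _ f _))

      arc-h : Arc triangle-plan w u
      arc-h = arc h h-joins (↦-self _ h _)

    triangle-plan-returns : Returns 2 triangle-plan
    triangle-plan-returns (arc y J eq) with ↦-just _ h y eq
    ... | inj₁ (refl , d) with dir-determines-ends h-joins J d
    ...   | refl , refl = 2 , ≤-refl , arc-e ∷ arc-f ∷ []
    triangle-plan-returns (arc y J eq) | inj₂ eq′ with ↦-just _ f y eq′
    ... | inj₁ (refl , d) with dir-determines-ends f-joins J d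
    ...   | refl , refl = 2 , ≤-refl , arc-h ∷ arc-e ∷ []
    triangle-plan-returns (arc y J eq) | inj₂ _ | inj₂ eq″ with ↦-just ∅ e y eq″
    ... | inj₁ (refl , d) with dir-determines-ends e-joins J d
    ...   | refl , refl = 2 , ≤-refl , arc-f ∷ arc-h ∷ []
    triangle-plan-returns (arc y J eq) | inj₂ _ | inj₂ _ | inj₂ ()

    triangle-plan-compatible : Free p e (dir e-joins) → Free p f (dir f-joins) → Free p h (dir h-joins)
                             → Compatible triangle-plan p
    triangle-plan-compatible free-e free-f free-h =
      compatible-↦ (compatible-↦ (compatible-↦ compatible-∅ free-e) free-f) free-h

  orient-digon : 1 ≤ B → B ≤ C → Returns B p → (D : Digon e) → p e ≡ nothing
               → Free p (Digon.partner D) (dir (Digon.partner-joins D)) → Settling B C p e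
  orient-digon 1≤B B≤C r D unset-e free =
    settle-by-plan (≤-trans 1≤B B≤C) B≤C r (returns-weaken 1≤B (digon-plan-returns D))
              (digon-plan-compatible D (inj₁ unset-e) free) (digon-plan-e D)

  settle-digon : 1 ≤ B → B ≤ C → Returns B p → p e ≡ nothing → Digon e → Settling B C p e
  settle-digon {p = p} 1≤B B≤C r unset-e D with status p (Digon.partner-joins D)
  ... | unset eq   = orient-digon 1≤B B≤C r D unset-e (inj₁ eq)
  ... | along eq   = orient-digon 1≤B B≤C r D unset-e (inj₂ eq)
  ... | against eq = orient-digon 1≤B B≤C r (reverse-digon D) unset-e (inj₂ eq)

  orient-triangle : 2 ≤ B → B ≤ C → Returns B p → (T : Triangle e) → p e ≡ nothing
                  → Free p (Triangle.f T) (dir (Triangle.f-joins T))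
                  → Free p (Triangle.h T) (dir (Triangle.h-joins T)) → Settling B C p e
  orient-triangle 2≤B B≤C r T unset-e free-f free-h =
    settle-by-plan (≤-trans (s≤s z≤n) (≤-trans 2≤B B≤C)) B≤C r (returns-weaken 2≤B (triangle-plan-returns T))
              (triangle-plan-compatible T (inj₁ unset-e) free-f free-h) (triangle-plan-e T)

  settle-triangle : 2 ≤ B → suc B ≤ C → Returns B p → p e ≡ nothing → Triangle e → Settling B C p e
  settle-triangle {B} {C} {p} 2≤B B<C r unset-e T = by-status (status p f-joins) (status p h-joins)
    where
    open Triangle T
    B≤C = ≤-trans (n≤1+n B) B<C

    forward : Free p f (dir f-joins) → Free p h (dir h-joins) → Settling B C p _
    forward = orient-triangle 2≤B B≤C r T unset-e

    backward : Free p f (dir (joins-sym f-joins)) → Free p h (dir (joins-sym h-joins)) → Settling B C p _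
    backward free-f free-h = orient-triangle 2≤B B≤C r (reverse-triangle T) unset-e free-h free-f

    wedge : (Arc p u w × Arc p v w) ⊎ (Arc p w u × Arc p w v) → Settling B C p _
    wedge arcs = p , ⊑-refl , r , traversable-weaken B<C (wedge-traversable r e-joins arcs)

    by-status : Status p f-joins → Status p h-joins → Settling B C p _
    by-status (unset x)   (unset y)   = forward (inj₁ x) (inj₁ y)
    by-status (unset x)   (along y)   = forward (inj₁ x) (inj₂ y)
    by-status (along x)   (unset y)   = forward (inj₂ x) (inj₁ y)
    by-status (along x)   (along y)   = forward (inj₂ x) (inj₂ y)
    by-status (unset x)   (against y) = backward (inj₁ x) (inj₂ y)
    by-status (against x) (unset y)   = backward (inj₂ x) (inj₁ y)
    by-status (against x) (against y) = backward (inj₂ x) (inj₂ y)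
    by-status (along x)   (against y) = wedge (inj₁ (arc h (joins-sym h-joins) y , arc f f-joins x))
    by-status (against x) (along y)   = wedge (inj₂ (arc h h-joins y , arc f (joins-sym f-joins) x))

  -- The greedy orientation

  Settler : ℕ → ℕ → Set
  Settler B C = ∀ p → Returns B p → ∀ e → p e ≡ nothing → Settling B C p e

  settle : 1 ≤ C → B ≤ C → Settler B C → ∀ p → Returns B p → ∀ e → Settling B C p e
  settle 1≤C B≤C settle-unset p r e with p e in eq
  ... | just _  = settle-oriented 1≤C B≤C r eq
  ... | nothing = settle-unset p r e eq

  settle-list : 1 ≤ C → B ≤ C → Settler B C → ∀ (es : List (Edge G)) p → Returns B p
              → ∃ λ q → p ⊑ q × Returns B q × All (Traversable C q) es
  settle-list _ _ _ [] p r = p , ⊑-refl , r , []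
  settle-list 1≤C B≤C settle-unset (e ∷ es) p r with settle 1≤C B≤C settle-unset p r e
  ... | q , p⊑q , rq , te with settle-list 1≤C B≤C settle-unset es q rq
  ... | s , q⊑s , rs , tes = s , ⊑-trans p⊑q q⊑s , rs , traversable-⊑ q⊑s te ∷ tes

  traversable-orientation : 1 ≤ C → B ≤ C → Settler B C
                          → Σ (Orientation G) λ o → ∀ e → Traversable C (total o) e
  traversable-orientation 1≤C B≤C settle-unset
    with settle-list 1≤C B≤C settle-unset (allFin m) ∅ returns-∅
  ... | p , _ , _ , t = complete p , λ e → traversable-⊑ (complete-⊒ p) (All.lookup t (∈-allFin e))

  next-next : (i : Fin 2) → next G (next G i) ≡ i
  next-next zero       = refl
  next-next (suc zero) = refl

  next-≢₂ : (i : Fin 2) → i ≢ next G i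
  next-≢₂ zero       ()
  next-≢₂ (suc zero) ()

  next-next-next : (i : Fin 3) → next G (next G (next G i)) ≡ i
  next-next-next zero             = refl
  next-next-next (suc zero)       = refl
  next-next-next (suc (suc zero)) = refl

  next-≢₃ : (i : Fin 3) → i ≢ next G i
  next-≢₃ zero             ()
  next-≢₃ (suc zero)       ()
  next-≢₃ (suc (suc zero)) ()

  next²-≢₃ : (i : Fin 3) → i ≢ next G (next G i)
  next²-≢₃ zero             ()
  next²-≢₃ (suc zero)       ()
  next²-≢₃ (suc (suc zero)) ()

  module _ {j} (vtx : Fin (suc (suc j)) → Vertex G) (edg : Fin (suc (suc j)) → Edge G) (edg-inj : Injective _≡_ _≡_ edg)
           (joins : ∀ i → Joins G (edg i) (vtx i) (vtx (next G i))) where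

    digon-in : j ≡ 0 → ∀ i → Digon (edg i)
    digon-in refl i = record
      { partner = edg (next G i) ; e-joins = joins i
      ; partner-joins = subst (Joins G _ _) (cong vtx (next-next i)) (joins (next G i))
      ; distinct = λ eq → next-≢₂ i (edg-inj eq) }

    triangle-in : j ≡ 1 → ∀ i → Triangle (edg i)
    triangle-in refl i = record
      { f = edg (next G i) ; h = edg (next G (next G i))
      ; e-joins = joins i ; f-joins = joins (next G i)
      ; h-joins = subst (Joins G _ _) (cong vtx (next-next-next i)) (joins (next G (next G i)))
      ; e≢f = λ eq → next-≢₃ i (edg-inj eq)
      ; f≢h = λ eq → next-≢₃ (next G i) (edg-inj eq)
      ; e≢h = λ eq → next²-≢₃ i (edg-inj eq) }

  short-cycle : ∀ {g} → MaxEdgeGirth G g → ∀ e → Σ (Cycle G) λ C → ContainsEdge G C e × cycleLength G C ≤ g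
  short-cycle (girths , _) e with girths e
  ... | _ , ((C , C∋e , refl) , _) , length≤g = C , C∋e , length≤g

  digon-of-cycle : (C : Cycle G) → ContainsEdge G C e → cycleLength G C ≤ 2 → Digon e
  digon-of-cycle record { j = 0 ; vtx = vtx ; edg = edg ; edg-inj = inj ; joins = J } (i , refl) _ =
    digon-in vtx edg inj J refl i
  digon-of-cycle record { j = suc _ } _ (s≤s (s≤s ()))

  digon-or-triangle : (C : Cycle G) → ContainsEdge G C e → cycleLength G C ≤ 3 → Digon e ⊎ Triangle e
  digon-or-triangle C@record { j = 0 } C∋e _ = inj₁ (digon-of-cycle C C∋e ≤-refl)
  digon-or-triangle record { j = 1 ; vtx = vtx ; edg = edg ; edg-inj = inj ; joins = J } (i , refl) _ =
    inj₂ (triangle-in vtx edg inj J refl i)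
  digon-or-triangle record { j = suc (suc _) } _ (s≤s (s≤s (s≤s ())))

  girth-two-orientation : MaxEdgeGirth G 2 → Σ (Orientation G) λ o → ∀ e → Traversable 1 (total o) e
  girth-two-orientation girth = traversable-orientation ≤-refl ≤-refl settle-unset
    where
    settle-unset : Settler 1 1
    settle-unset p r e unset-e with short-cycle girth e
    ... | C , C∋e , length≤2 = settle-digon ≤-refl ≤-refl r unset-e (digon-of-cycle C C∋e length≤2)

  girth-three-orientation : MaxEdgeGirth G 3 → Σ (Orientation G) λ o → ∀ e → Traversable 3 (total o) e
  girth-three-orientation girth = traversable-orientation (s≤s z≤n) (n≤1+n 2) settle-unset
    where
    settle-unset : Settler 2 3
    settle-unset p r e unset-e with short-cycle girth e
    ... | C , C∋e , length≤3 with digon-or-triangle C C∋e length≤3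
    ...   | inj₁ D = settle-digon (s≤s z≤n) (n≤1+n 2) r unset-e D
    ...   | inj₂ T = settle-triangle ≤-refl ≤-refl r unset-e T

  -- Directed walks from walks

  directs : ∀ o (J : Joins G e a b) → o e ≡ dir J → tail G o e ≡ a × head G o e ≡ b
  directs {e} o J eq with o e
  directs o (inj₁ (s , t)) refl | true  = s , t
  directs o (inj₂ (s , t)) refl | false = t , s

  tail-head-joins : ∀ o e → Joins G e (tail G o e) (head G o e)
  tail-head-joins o e with o e
  ... | true  = inj₁ (refl , refl)
  ... | false = inj₂ (refl , refl)

  to-dwalk : ∀ {o} → Path (Arc (total o)) a b k → DWalk G o a b k
  to-dwalk [] = []
  to-dwalk {o = o} (arc e J eq ∷ p) with directs o J (just-injective eq)
  ... | refl , refl = step e (to-dwalk p)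

  to-walk : ∀ {o} → DWalk G o a b k → Walk G (AnyEdge G) a b k
  to-walk [] = []
  to-walk {o = o} (step e w) = step e tt (tail-head-joins o e) (to-walk w)

  stretch : ∀ {o P} → (∀ e → Traversable C (total o) e) → Walk G P a b k → Reach (total o) (C * k) a b
  stretch t [] = 0 , z≤n , []
  stretch {C} {k = suc k} t (step e _ J w) =
    within-weaken (≤-reflexive (sym (*-suc C k))) (within-++ (t e J) (stretch t w))

  distance-preserved : ∀ {o} → (∀ e → Traversable 1 (total o) e) → Dist G a b k → DDist G o a b k
  distance-preserved {a} {b} {k} {o} t (w , shortest) with stretch t w
  ... | k′ , k′≤1*k , p =
    subst (DWalk G o a b) k′≡k (to-dwalk p) , λ j j<k dw → shortest j j<k (to-walk dw)
    where
    k′≡k = ≤-antisym (≤-trans k′≤1*k (≤-reflexive (*-identityˡ k)))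
                     (≮⇒≥ λ k′<k → shortest k′ k′<k (to-walk (to-dwalk p)))

  diameter-preserved : ∀ {o d} → (∀ e → Traversable 1 (total o) e) → Diameter G d → DDiameter G o d
  diameter-preserved t (near , (u , v , far)) =
    (λ a b → let k , k≤d , δ = near a b in k , k≤d , distance-preserved t δ) , u , v , distance-preserved t far

  diameter-stretched : ∀ {o d} → (∀ e → Traversable C (total o) e) → Diameter G d → DDiameter≤ G o (C * d)
  diameter-stretched {C} t (near , _) a b with near a b
  ... | k , k≤d , (w , _) with stretch t w
  ...   | k′ , k′≤Ck , p = k′ , ≤-trans k′≤Ck (*-monoʳ-≤ C k≤d) , to-dwalk p

theorem1p2 : (d : ℕ) → 1 ≤ d → (G : Multigraph) → Connected G → Bridgeless G
           → Diameter G d → (g : ℕ) → MaxEdgeGirth G g → (g ≡ 2 ⊎ g ≡ 3)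
           → Σ (Orientation G) (λ o → (g ≡ 2 → DDiameter G o d)
                                    × (g ≡ 3 → DDiameter≤ G o (3 * d)))
theorem1p2 d _ G _ _ diameter _ girth (inj₁ refl) =
  let o , t = girth-two-orientation G girth in o , (λ _ → diameter-preserved G t diameter) , λ ()
theorem1p2 d _ G _ _ diameter _ girth (inj₂ refl) =
  let o , t = girth-three-orientation G girth in o , (λ ()) , λ _ → diameter-stretched G t diameter
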